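{- Let $n\ge 2$ and let $\pi\in S_n$ be written as $\pi=\alpha\,2\,\beta\,1$, where $\alpha$ and $\beta$ are (possibly empty) words, $|\alpha|=k$. Then $\pi$ is cyclic and 312-avoiding if and only if the word $\alpha 21$ is a permutation of $[k+2]$ (i.e., the entries of $\alpha$ are exactly $3,\dots,k+2$) that is cyclic and 312-avoiding, and $\mathrm{red}(\beta 1)\in S_{n-k-1}$ is cyclic and 312-avoiding.
   Context: Pattern containment/avoidance: $\pi\in S_n$ contains $\sigma\in S_k$ if some subsequence $\pi_{i_1}\cdots\pi_{i_k}$ ($i_1<\dots<i_k$) is order-isomorphic to $\sigma$; otherwise it avoids $\sigma$. A permutation is cyclic if it consists of a single cycle. For a word $w$ of distinct integers of length $j$, $\mathrm{red}(w)\in S_j$ is the permutation in the same relative order as $w$. -}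

module Defs where

open import Data.Nat using (ℕ; zero; suc; _+_; _∸_; _<_; _≤_; _<ᵇ_)
open import Data.Bool using (if_then_else_)
open import Data.List using (List; []; _∷_; map; upTo; length; filter; _++_)
open import Data.List.Relation.Binary.Permutation.Propositional using (_↭_)
open import Data.List.Relation.Binary.Sublist.Propositional using (_⊆_)
open import Data.Product using (Σ; _×_; ∃)
open import Relation.Binary.PropositionalEquality using (_≡_)
open import Relation.Nullary using (¬_)
open import Function.Bundles using (_⇔_)

range : ℕ → List ℕ
range n = map suc (upTo n)

-- w (one-line notation) is a permutation of [n], i.e. an element of S_n
IsPerm : ℕ → List ℕ → Set
IsPerm n w = w ↭ range n

nth : List ℕ → ℕ → ℕ
nth []       _       = 0
nth (x ∷ _)  zero    = x
nth (_ ∷ xs) (suc i) = nth xs i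

-- the permutation as a function: π(i) = w_i (1-based)
apply : List ℕ → ℕ → ℕ
apply w i = nth w (i ∸ 1)

iter : List ℕ → ℕ → ℕ → ℕ
iter w zero    i = i
iter w (suc m) i = apply w (iter w m i)

-- cyclic: consists of a single cycle, i.e. every element of [n] lies in the orbit of every other
Cyclic : ℕ → List ℕ → Set
Cyclic n w = ∀ i j → 1 ≤ i → i ≤ n → 1 ≤ j → j ≤ n → ∃ λ m → iter w m i ≡ j

OrderIso : List ℕ → List ℕ → Set
OrderIso u v = (length u ≡ length v) ×
  (∀ a b → a < length u → b < length u → (nth u a < nth u b ⇔ nth v a < nth v b))

Contains : List ℕ → List ℕ → Set
Contains w σ = Σ (List ℕ) λ s → (s ⊆ w) × OrderIso s σ

Avoids : List ℕ → List ℕ → Set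
Avoids w σ = ¬ Contains w σ

countLess : ℕ → List ℕ → ℕ
countLess x []       = 0
countLess x (y ∷ ys) = if y <ᵇ x then suc (countLess x ys) else countLess x ys

red : List ℕ → List ℕ
red w = map (λ x → suc (countLess x w)) w

p312 : List ℕ
p312 = 3 ∷ 1 ∷ 2 ∷ []

module Submission where

-- If π = α 2 β 1 avoids 312, every entry of α is below every entry of β, since otherwise
-- x 2 y would be an occurrence of 312; so α permutes 3, …, k + 2 and β permutes k + 3, …, n
-- (conversely, the first half is immediate when α 2 1 is a permutation of [k + 2]).
-- With these blocks, an occurrence of 312 in π lies inside α 2 or inside β, because the final
-- 1 is below everything and α 2 is below β; and red (β 1) is β shifted down by k + 1, then 1.
-- As a map, π is the cycle τ = α 2 1 on [1, k + 2] with σ = red (β 1), shifted up by k + 1,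
-- spliced in at k + 2.  Runs of τ and σ lift to runs of π, and collapsing a run of π onto
-- either block gives a run of τ or of σ, so π is cyclic exactly when τ and σ are.

open import Defs
open import Data.Nat
  using (ℕ; zero; suc; _+_; _∸_; _≤_; _<_; _⊓_; _⊔_; z≤n; s≤s; s≤s⁻¹; z<s; _≤?_; _<?_; _≟_; _<ᵇ_)
open import Data.Nat.Properties
open import Data.Bool using (true; false)
open import Data.List using (List; []; _∷_; [_]; _++_; length; map; filter; applyUpTo)
open import Data.List.Properties
  using (length-++; length-map; map-upTo; map-++; map-cong-local; filter-accept; filter-all; filter-none; filter-++; ++-identityʳ)
  renaming (++-assoc to ++-assoc-≡)
open import Data.List.Extrema.Nat using (max; ⊥≤max; xs≤max; argmax-all)
open import Data.List.Membership.Propositional using (_∈_)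
open import Data.List.Membership.Propositional.Properties using (∈-map⁺; ∈-map⁻; ∈-++⁺ˡ; ∈-++⁺ʳ; ∈-++⁻)
open import Data.List.Relation.Unary.Any using (here; there)
open import Data.List.Relation.Unary.All as All using (All; []; _∷_)
open import Data.List.Relation.Unary.All.Properties using () renaming (map⁺ to All-map⁺)
open import Data.List.Relation.Unary.Unique.Propositional using (Unique; []; _∷_)
open import Data.List.Relation.Binary.Permutation.Propositional
  using (_↭_; prep; swap; ↭-refl; ↭-sym; ↭-trans; ↭⇒↭ₛ; module PermutationReasoning)
open import Data.List.Relation.Binary.Permutation.Propositional.Properties
  using (∈-resp-↭; ↭-length; drop-∷; filter-↭; ++⁺ʳ; ++⁺ˡ; shift; ∷↭∷ʳ)
import Data.List.Relation.Binary.Permutation.Setoid.Properties as Setoid↭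
open import Data.List.Relation.Binary.Sublist.Propositional using (_⊆_; []; _∷_; _∷ʳ_; from∈; to∈)
open import Data.Product using (_×_; _,_; proj₁; proj₂; ∃)
open import Data.Sum as Sum using (_⊎_; inj₁; inj₂)
open import Relation.Nullary using (¬_; yes; no; contradiction)
open import Relation.Binary.PropositionalEquality
  using (_≡_; _≢_; refl; sym; trans; cong; cong₂; subst; subst₂; setoid; module ≡-Reasoning)
open import Function.Base using (id; _∘_)
open import Function.Bundles using (_⇔_; mk⇔; Equivalence)
open import Function.Properties.Equivalence using () renaming (refl to ⇔-refl; trans to ⇔-trans)
open import Data.Product.Function.NonDependent.Propositional using (_×-⇔_)

segment : ℕ → ℕ → List ℕ
segment a zero    = []
segment a (suc c) = suc a ∷ segment (suc a) c

length-segment : ∀ a c → length (segment a c) ≡ c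
length-segment a zero    = refl
length-segment a (suc c) = cong suc (length-segment (suc a) c)

segment-++ : ∀ a b c → segment a (b + c) ≡ segment a b ++ segment (b + a) c
segment-++ a zero    c = refl
segment-++ a (suc b) c rewrite segment-++ (suc a) b c | +-suc b a = refl

∈-segment⁻ : ∀ {x} a c → x ∈ segment a c → a < x × x ≤ a + c
∈-segment⁻ a (suc c) (here refl) = ≤-refl , subst (suc a ≤_) (sym (+-suc a c)) (s≤s (m≤m+n a c))
∈-segment⁻ {x} a (suc c) (there x∈) with ∈-segment⁻ (suc a) c x∈
... | a<x , x≤ = <-trans (n<1+n a) a<x , subst (x ≤_) (sym (+-suc a c)) x≤

∈-segment-split : ∀ {x} a c → x ∈ segment a c → ∃ λ b → ∃ λ d → x ≡ suc (b + a) × c ≡ b + suc d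
∈-segment-split a (suc c) (here refl) = 0 , c , refl , refl
∈-segment-split a (suc c) (there x∈) with ∈-segment-split (suc a) c x∈
... | b , d , refl , refl = suc b , d , cong suc (+-suc b a) , refl

applyUpTo-segment : ∀ f a n → (∀ i → f i ≡ suc (a + i)) → applyUpTo f n ≡ segment a n
applyUpTo-segment f a zero    f≗ = refl
applyUpTo-segment f a (suc n) f≗ = cong₂ _∷_ (trans (f≗ 0) (cong suc (+-identityʳ a)))
  (applyUpTo-segment (λ i → f (suc i)) (suc a) n (λ i → trans (f≗ (suc i)) (cong suc (+-suc a i))))

range≡segment : ∀ n → range n ≡ segment 0 n
range≡segment n = trans (map-upTo suc n) (applyUpTo-segment suc 0 n (λ _ → refl))

segment-unique : ∀ a c → Unique (segment a c)
segment-unique a zero    = []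
segment-unique a (suc c) =
  All.tabulate (λ x∈ → <⇒≢ (proj₁ (∈-segment⁻ (suc a) c x∈))) ∷ segment-unique (suc a) c

filter-<-segment : ∀ a b c → filter (_<? suc (b + a)) (segment a (b + c)) ≡ segment a b
filter-<-segment a b c = begin
  filter (_<? t) (segment a (b + c))
    ≡⟨ cong (filter (_<? t)) (segment-++ a b c) ⟩
  filter (_<? t) (segment a b ++ segment (b + a) c)
    ≡⟨ filter-++ (_<? t) (segment a b) _ ⟩
  filter (_<? t) (segment a b) ++ filter (_<? t) (segment (b + a) c)
    ≡⟨ cong₂ _++_ (filter-all (_<? t) (All.tabulate below)) (filter-none (_<? t) (All.tabulate above)) ⟩
  segment a b ++ []
    ≡⟨ ++-identityʳ (segment a b) ⟩
  segment a b ∎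
  where
  open ≡-Reasoning
  t : ℕ
  t = suc (b + a)
  below : ∀ {x} → x ∈ segment a b → x < t
  below {x} x∈ = s≤s (subst (x ≤_) (+-comm a b) (proj₂ (∈-segment⁻ a b x∈)))
  above : ∀ {x} → x ∈ segment (b + a) c → ¬ x < t
  above x∈ x<t = <⇒≱ (proj₁ (∈-segment⁻ (b + a) c x∈)) (≤-pred x<t)

++-cancelˡ-↭ : ∀ {A : Set} (xs : List A) {ys zs} → xs ++ ys ↭ xs ++ zs → ys ↭ zs
++-cancelˡ-↭ []       p = p
++-cancelˡ-↭ (x ∷ xs) p = ++-cancelˡ-↭ xs (drop-∷ p)

unique-↭ : ∀ {xs ys : List ℕ} → xs ↭ ys → Unique xs → Unique ys
unique-↭ p = Setoid↭.Unique-resp-↭ (setoid ℕ) (↭⇒↭ₛ p)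

unique-++⇒≢ : ∀ (xs : List ℕ) {ys x y} → Unique (xs ++ ys) → x ∈ xs → y ∈ ys → x ≢ y
unique-++⇒≢ (_ ∷ xs) (x≢ ∷ _) (here refl) y∈ = All.lookup x≢ (∈-++⁺ʳ xs y∈)
unique-++⇒≢ (_ ∷ xs) (_ ∷ u)  (there x∈)  y∈ = unique-++⇒≢ xs u x∈ y∈

-- Filtering at the threshold max a u separates u from v.
lower-block : ∀ a c u v → u ++ v ↭ segment a c → (∀ {x y} → x ∈ u → y ∈ v → x < y) →
              u ↭ segment a (length u)
lower-block a c u v p u<v = subst (λ b → u ↭ segment a b) b≡length u↭
  where
  t b : ℕ
  t = max a u
  b = t ∸ a
  t≤ : t ≤ a + c
  t≤ = argmax-all id {xs = u} (m≤m+n a c)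
         (All.tabulate (λ x∈ → proj₂ (∈-segment⁻ a c (∈-resp-↭ p (∈-++⁺ˡ x∈)))))
  b≤c : b ≤ c
  b≤c = m≤n+o⇒m∸n≤o t a t≤
  t<v : ∀ {y} → y ∈ v → t < y
  t<v y∈ = argmax-all id {xs = u} (proj₁ (∈-segment⁻ a c (∈-resp-↭ p (∈-++⁺ʳ u y∈))))
             (All.tabulate (λ x∈ → u<v x∈ y∈))
  filter-uv : filter (_<? suc t) (u ++ v) ≡ u
  filter-uv = begin
    filter (_<? suc t) (u ++ v)                       ≡⟨ filter-++ (_<? suc t) u v ⟩
    filter (_<? suc t) u ++ filter (_<? suc t) v     ≡⟨ cong₂ _++_ (filter-all (_<? suc t) u≤t) (filter-none (_<? suc t) v≰t) ⟩
    u ++ []                                           ≡⟨ ++-identityʳ u ⟩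
    u                                                 ∎
    where
    open ≡-Reasoning
    u≤t : All (_< suc t) u
    u≤t = All.map s≤s (xs≤max a u)
    v≰t : All (λ y → ¬ y < suc t) v
    v≰t = All.tabulate (λ y∈ y≤t → <⇒≱ (t<v y∈) (≤-pred y≤t))
  filter-segment : filter (_<? suc t) (segment a c) ≡ segment a b
  filter-segment = subst (λ s → filter (_<? suc s) (segment a c) ≡ segment a b) (m∸n+n≡m (⊥≤max a u))
    (subst (λ c′ → filter (_<? suc (b + a)) (segment a c′) ≡ segment a b) (m+[n∸m]≡n b≤c)
      (filter-<-segment a b (c ∸ b)))
  u↭ : u ↭ segment a b
  u↭ = subst₂ _↭_ filter-uv filter-segment (filter-↭ (_<? suc t) p)
  b≡length : b ≡ length u
  b≡length = trans (sym (length-segment a b)) (sym (↭-length u↭))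

countLess≡length-filter : ∀ x w → countLess x w ≡ length (filter (_<? x) w)
countLess≡length-filter x []      = refl
countLess≡length-filter x (y ∷ w) with y <ᵇ x
... | true  = cong suc (countLess≡length-filter x w)
... | false = countLess≡length-filter x w

red-shift : ∀ K m β → β ↭ segment (suc K) m → red (β ++ [ 1 ]) ≡ map (_∸ K) β ++ [ 1 ]
red-shift K m β p = begin
  map rank (β ++ [ 1 ])     ≡⟨ map-++ rank β [ 1 ] ⟩
  map rank β ++ [ rank 1 ]  ≡⟨ cong₂ _++_ (map-cong-local (All.tabulate rank-β)) (cong [_] rank-1) ⟩
  map (_∸ K) β ++ [ 1 ]     ∎
  where
  open ≡-Reasoning
  w : List ℕ
  w = β ++ [ 1 ]
  rank : ℕ → ℕ
  rank x = suc (countLess x w)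
  positive : ∀ {y} → y ∈ w → 0 < y
  positive y∈ with ∈-++⁻ β y∈
  ... | inj₁ y∈β        = <-trans z<s (proj₁ (∈-segment⁻ (suc K) m (∈-resp-↭ p y∈β)))
  ... | inj₂ (here refl) = z<s
  rank-1 : rank 1 ≡ 1
  rank-1 = cong suc (trans (countLess≡length-filter 1 w)
    (cong length (filter-none (_<? 1) (All.tabulate (λ y∈ y<1 → <⇒≱ (positive y∈) (≤-pred y<1))))))
  rank-β : ∀ {y} → y ∈ β → rank y ≡ y ∸ K
  rank-β y∈ with ∈-segment-split (suc K) m (∈-resp-↭ p y∈)
  ... | b , d , refl , refl = begin
    suc (countLess y w)
      ≡⟨ cong suc (countLess≡length-filter y w) ⟩
    suc (length (filter (_<? y) w))
      ≡⟨ cong suc (↭-length (filter-↭ (_<? y) (↭-sym (∷↭∷ʳ 1 β)))) ⟩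
    suc (length (filter (_<? y) (1 ∷ β)))
      ≡⟨ cong (λ l → suc (length l)) (filter-accept (_<? y) 1<y) ⟩
    suc (suc (length (filter (_<? y) β)))
      ≡⟨ cong (λ n → suc (suc n)) (↭-length (filter-↭ (_<? y) p)) ⟩
    suc (suc (length (filter (_<? y) (segment (suc K) (b + suc d)))))
      ≡⟨ cong (λ l → suc (suc (length l))) (filter-<-segment (suc K) b (suc d)) ⟩
    suc (suc (length (segment (suc K) b)))
      ≡⟨ cong (λ n → suc (suc n)) (length-segment (suc K) b) ⟩
    suc (suc b)
      ≡⟨ sym (m+n∸n≡m (suc (suc b)) K) ⟩
    suc (suc (b + K)) ∸ K
      ≡⟨ cong (λ n → suc n ∸ K) (sym (+-suc b K)) ⟩
    y ∸ K ∎
    where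
    y : ℕ
    y = suc (b + suc K)
    1<y : 1 < y
    1<y = s≤s (≤-trans (s≤s z≤n) (m≤n+m (suc K) b))

-- Occurrences of the pattern 312

data InOrder (y z : ℕ) : List ℕ → Set where
  here  : ∀ {w} → z ∈ w → InOrder y z (y ∷ w)
  there : ∀ {a w} → InOrder y z w → InOrder y z (a ∷ w)

data Has312 : List ℕ → Set where
  here  : ∀ {x y z w} → y < z → z < x → InOrder y z w → Has312 (x ∷ w)
  there : ∀ {a w} → Has312 w → Has312 (a ∷ w)

InOrder⇒∈ˡ : ∀ {y z w} → InOrder y z w → y ∈ w
InOrder⇒∈ˡ (here _)   = here refl
InOrder⇒∈ˡ (there io) = there (InOrder⇒∈ˡ io)

InOrder⇒∈ʳ : ∀ {y z w} → InOrder y z w → z ∈ w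
InOrder⇒∈ʳ (here z∈)  = there z∈
InOrder⇒∈ʳ (there io) = there (InOrder⇒∈ʳ io)

InOrder-++⁺ˡ : ∀ {y z u} v → InOrder y z u → InOrder y z (u ++ v)
InOrder-++⁺ˡ v (here z∈)  = here (∈-++⁺ˡ z∈)
InOrder-++⁺ˡ v (there io) = there (InOrder-++⁺ˡ v io)

InOrder-++⁺ʳ : ∀ {y z v} u → InOrder y z v → InOrder y z (u ++ v)
InOrder-++⁺ʳ []      io = io
InOrder-++⁺ʳ (_ ∷ u) io = there (InOrder-++⁺ʳ u io)

InOrder-++⁻ : ∀ {y z v} u → InOrder y z (u ++ v) → InOrder y z u ⊎ z ∈ v
InOrder-++⁻ []      io = inj₂ (InOrder⇒∈ʳ io)
InOrder-++⁻ (_ ∷ u) (here z∈) with ∈-++⁻ u z∈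
... | inj₁ z∈u = inj₁ (here z∈u)
... | inj₂ z∈v = inj₂ z∈v
InOrder-++⁻ (_ ∷ u) (there io) with InOrder-++⁻ u io
... | inj₁ io′ = inj₁ (there io′)
... | inj₂ z∈v = inj₂ z∈v

InOrder-map⁺ : ∀ f {y z v} → InOrder y z v → InOrder (f y) (f z) (map f v)
InOrder-map⁺ f (here z∈)  = here (∈-map⁺ f z∈)
InOrder-map⁺ f (there io) = there (InOrder-map⁺ f io)

InOrder-map⁻ : ∀ f {y z} v → InOrder y z (map f v) →
               ∃ λ b → ∃ λ c → y ≡ f b × z ≡ f c × InOrder b c v
InOrder-map⁻ f (a ∷ v) (here z∈) with ∈-map⁻ f z∈
... | c , c∈ , refl = a , c , refl , refl , here c∈
InOrder-map⁻ f (a ∷ v) (there io) with InOrder-map⁻ f v io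
... | b , c , y≡ , z≡ , io′ = b , c , y≡ , z≡ , there io′

Has312-++⁺ˡ : ∀ {u} v → Has312 u → Has312 (u ++ v)
Has312-++⁺ˡ v (here y<z z<x io) = here y<z z<x (InOrder-++⁺ˡ v io)
Has312-++⁺ˡ v (there p)         = there (Has312-++⁺ˡ v p)

Has312-++⁺ʳ : ∀ {v} u → Has312 v → Has312 (u ++ v)
Has312-++⁺ʳ []      p = p
Has312-++⁺ʳ (_ ∷ u) p = there (Has312-++⁺ʳ u p)

Has312-++⁺-across : ∀ {x y z u v} → x ∈ u → y < z → z < x → InOrder y z v → Has312 (u ++ v)
Has312-++⁺-across {u = _ ∷ u} (here refl) y<z z<x io = here y<z z<x (InOrder-++⁺ʳ u io)
Has312-++⁺-across {u = _ ∷ u} (there x∈)  y<z z<x io = there (Has312-++⁺-across x∈ y<z z<x io)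

data Split312 (u v : List ℕ) : Set where
  left   : Has312 u → Split312 u v
  right  : Has312 v → Split312 u v
  across : ∀ {x y z} → x ∈ u → y ∈ u ++ v → z ∈ v → y < z → z < x → Split312 u v

Has312-++⁻ : ∀ u {v} → Has312 (u ++ v) → Split312 u v
Has312-++⁻ []      p = right p
Has312-++⁻ (_ ∷ u) (here y<z z<x io) with InOrder-++⁻ u io
... | inj₁ io′ = left (here y<z z<x io′)
... | inj₂ z∈v = across (here refl) (there (InOrder⇒∈ˡ io)) z∈v y<z z<x
Has312-++⁻ (_ ∷ u) (there p) with Has312-++⁻ u p
... | left q                   = left (there q)
... | right q                  = right q
... | across x∈ y∈ z∈ y<z z<x  = across (there x∈) (there y∈) z∈ y<z z<x

Has312-++-stacked : ∀ u {v} → (∀ {x y} → x ∈ u → y ∈ v → x < y) →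
                    Has312 (u ++ v) → Has312 u ⊎ Has312 v
Has312-++-stacked u u<v p with Has312-++⁻ u p
... | left q                 = inj₁ q
... | right q                = inj₂ q
... | across x∈ _ z∈ _ z<x   = contradiction z<x (<-asym (u<v x∈ z∈))

Has312-∷ʳ-min : ∀ {b} u → All (b ≤_) u → Has312 (u ++ [ b ]) → Has312 u
Has312-∷ʳ-min {b} u b≤u p with Has312-++⁻ u p
... | left q                          = q
... | right (here _ _ ())
... | right (there ())
... | across _ y∈ (here refl) y<b _   = contradiction (b≤ (∈-++⁻ u y∈)) (<⇒≱ y<b)
  where
  b≤ : ∀ {y} → y ∈ u ⊎ y ∈ [ b ] → b ≤ y
  b≤ (inj₁ y∈u)        = All.lookup b≤u y∈u
  b≤ (inj₂ (here refl)) = ≤-refl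

Has312-map⁺ : ∀ f {v} → (∀ {a b} → a ∈ v → b ∈ v → a < b → f a < f b) → Has312 v → Has312 (map f v)
Has312-map⁺ f mono (here y<z z<x io) =
  here (mono (there (InOrder⇒∈ˡ io)) (there (InOrder⇒∈ʳ io)) y<z)
       (mono (there (InOrder⇒∈ʳ io)) (here refl) z<x)
       (InOrder-map⁺ f io)
Has312-map⁺ f mono (there p) = there (Has312-map⁺ f (λ a∈ b∈ → mono (there a∈) (there b∈)) p)

Has312-map⁻ : ∀ f → (∀ {a b} → f a < f b → a < b) → ∀ v → Has312 (map f v) → Has312 v
Has312-map⁻ f reflects (_ ∷ v) (here y<z z<x io) with InOrder-map⁻ f v io
... | _ , _ , refl , refl , io′ = here (reflects y<z) (reflects z<x) io′
Has312-map⁻ f reflects (_ ∷ v) (there p) = there (Has312-map⁻ f reflects v p)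

InOrder⇒⊆ : ∀ {y z w} → InOrder y z w → (y ∷ z ∷ []) ⊆ w
InOrder⇒⊆ (here z∈)             = refl ∷ from∈ z∈
InOrder⇒⊆ {w = a ∷ _} (there io) = a ∷ʳ InOrder⇒⊆ io

⊆⇒InOrder : ∀ {y z w} → (y ∷ z ∷ []) ⊆ w → InOrder y z w
⊆⇒InOrder (_ ∷ʳ s)   = there (⊆⇒InOrder s)
⊆⇒InOrder (refl ∷ s) = here (to∈ s)

⊆⇒Has312 : ∀ {x y z w} → (x ∷ y ∷ z ∷ []) ⊆ w → y < z → z < x → Has312 w
⊆⇒Has312 (_ ∷ʳ s)   y<z z<x = there (⊆⇒Has312 s y<z z<x)
⊆⇒Has312 (refl ∷ s) y<z z<x = here y<z z<x (⊆⇒InOrder s)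

Has312⇒⊆ : ∀ {w} → Has312 w → ∃ λ x → ∃ λ y → ∃ λ z → (x ∷ y ∷ z ∷ []) ⊆ w × y < z × z < x
Has312⇒⊆ (here y<z z<x io) = _ , _ , _ , refl ∷ InOrder⇒⊆ io , y<z , z<x
Has312⇒⊆ {a ∷ _} (there p) with Has312⇒⊆ p
... | x , y , z , s , y<z , z<x = x , y , z , a ∷ʳ s , y<z , z<x

orderIso-312 : ∀ {x y z} → y < z → z < x → OrderIso (x ∷ y ∷ z ∷ []) p312
orderIso-312 {x} {y} {z} y<z z<x = refl , iso
  where
  y<x : y < x
  y<x = <-trans y<z z<x
  both : ∀ {A B : Set} → A → B → A ⇔ B
  both a b = mk⇔ (λ _ → b) (λ _ → a)
  neither : ∀ {A B : Set} → ¬ A → ¬ B → A ⇔ B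
  neither ¬a ¬b = mk⇔ (λ a → contradiction a ¬a) (λ b → contradiction b ¬b)
  iso : ∀ a b → a < 3 → b < 3 →
        (nth (x ∷ y ∷ z ∷ []) a < nth (x ∷ y ∷ z ∷ []) b ⇔ nth p312 a < nth p312 b)
  iso 0 0 _ _ = neither (<-irrefl refl) (<-irrefl refl)
  iso 0 1 _ _ = neither (<-asym y<x) (<-asym (s≤s (s≤s z≤n)))
  iso 0 2 _ _ = neither (<-asym z<x) (<-asym ≤-refl)
  iso 1 0 _ _ = both y<x (s≤s (s≤s z≤n))
  iso 1 1 _ _ = neither (<-irrefl refl) (<-irrefl refl)
  iso 1 2 _ _ = both y<z ≤-refl
  iso 2 0 _ _ = both z<x ≤-refl
  iso 2 1 _ _ = neither (<-asym y<z) (<-asym ≤-refl)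
  iso 2 2 _ _ = neither (<-irrefl refl) (<-irrefl refl)
  iso (suc (suc (suc _))) _ (s≤s (s≤s (s≤s ()))) _
  iso _ (suc (suc (suc _))) _ (s≤s (s≤s (s≤s ())))

Has312⇒Contains : ∀ {w} → Has312 w → Contains w p312
Has312⇒Contains p with Has312⇒⊆ p
... | x , y , z , s , y<z , z<x = x ∷ y ∷ z ∷ [] , s , orderIso-312 y<z z<x

Contains⇒Has312 : ∀ {w} → Contains w p312 → Has312 w
Contains⇒Has312 (_ ∷ _ ∷ _ ∷ [] , s , refl , iso) =
  ⊆⇒Has312 s (Equivalence.from (iso 1 2 (s≤s (s≤s z≤n)) ≤-refl) ≤-refl)
             (Equivalence.from (iso 2 0 ≤-refl (s≤s z≤n)) ≤-refl)

avoids⇔¬Has312 : ∀ {w} → Avoids w p312 ⇔ (¬ Has312 w)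
avoids⇔¬Has312 = mk⇔ (λ av p → av (Has312⇒Contains p)) (λ ¬p c → ¬p (Contains⇒Has312 c))

-- Orbits and splicing of cycles

Reach : List ℕ → ℕ → ℕ → Set
Reach w a b = ∃ λ t → iter w t a ≡ b

reach-refl : ∀ {w a} → Reach w a a
reach-refl = 0 , refl

reach-step : ∀ {w a b} → apply w a ≡ b → Reach w a b
reach-step e = 1 , e

iter-+ : ∀ w s t a → iter w (s + t) a ≡ iter w s (iter w t a)
iter-+ w zero    t a = refl
iter-+ w (suc s) t a = cong (apply w) (iter-+ w s t a)

reach-trans : ∀ {w a b c} → Reach w a b → Reach w b c → Reach w a c
reach-trans {w} {a} (t , refl) (s , refl) = s + t , iter-+ w s t a

module Simulation (Inv : ℕ → Set) {w v : List ℕ} (φ : ℕ → ℕ)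
                  (Inv-closed : ∀ {y} → Inv y → Inv (apply w y)) where

  iter-closed : ∀ t {x} → Inv x → Inv (iter w t x)
  iter-closed zero    i = i
  iter-closed (suc t) i = Inv-closed (iter-closed t i)

  simulate : (∀ {y} → Inv y → Reach v (φ y) (φ (apply w y))) →
             ∀ {x y} → Inv x → Reach w x y → Reach v (φ x) (φ y)
  simulate step i (zero  , refl) = reach-refl
  simulate step i (suc t , refl) = reach-trans (simulate step i (t , refl)) (step (iter-closed t i))

  module _ (c : ℕ) (step : ∀ {y} → Inv y → y ≢ c → apply v (φ y) ≡ φ (apply w y)) where

    copy-or-hit : ∀ t {x} → Inv x → Reach v (φ x) (φ (iter w t x)) ⊎ Reach v (φ x) (φ c)
    copy-or-hit zero    i = inj₁ reach-refl
    copy-or-hit (suc t) {x} i with copy-or-hit t i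
    ... | inj₂ r = inj₂ r
    ... | inj₁ r with iter w t x ≟ c
    ...   | yes e = inj₂ (subst (Reach v (φ x)) (cong φ e) r)
    ...   | no ne = inj₁ (reach-trans r (reach-step (step (iter-closed t i) ne)))

    -- v copies the run of w step by step until that run first visits c.
    simulate-until : ∀ {x} → Inv x → Reach w x c → Reach v (φ x) (φ c)
    simulate-until {x} i (t , e) with copy-or-hit t i
    ... | inj₁ r = subst (Reach v (φ x)) (cong φ e) r
    ... | inj₂ r = r

≤-suc-cases : ∀ {y b} → y ≤ suc b → y ≤ b ⊎ y ≡ suc b
≤-suc-cases y≤ with m≤n⇒m<n∨m≡n y≤
... | inj₁ y< = inj₁ (s≤s⁻¹ y<)
... | inj₂ y≡ = inj₂ y≡

In : ℕ → ℕ → Set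
In n y = 1 ≤ y × y ≤ n

-- π on [1, m + 1 + K] is the cycle τ on [1, K + 1] with the cycle σ, shifted up by K,
-- spliced in at K + 1: where τ sends K + 1 to 1, π first runs through the shifted σ.
module Splice (K m : ℕ) (π τ σ : List ℕ)
  (π≈τ   : ∀ {y} → 1 ≤ y → y ≤ K → apply π y ≡ apply τ y)
  (τ-in  : ∀ {y} → In (suc K) y → In (suc K) (apply τ y))
  (τ-top : apply τ (suc K) ≡ 1)
  (π≈σ   : ∀ {j} → 1 ≤ j → j ≤ m → apply π (j + K) ≡ apply σ j + K)
  (σ-in  : ∀ {j} → 1 ≤ j → j ≤ m → 2 ≤ apply σ j × apply σ j ≤ suc m)
  (π-top : apply π (suc m + K) ≡ 1)
  (σ-top : apply σ (suc m) ≡ 1) where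

  N : ℕ
  N = suc m + K

  sK≤N : suc K ≤ N
  sK≤N = s≤s (m≤n+m K m)

  data Zone (y : ℕ) : Set where
    low : y ≤ K → Zone y
    mid : ∀ {j} → 1 ≤ j → j ≤ m → y ≡ j + K → Zone y
    top : y ≡ N → Zone y

  zone : ∀ {y} → y ≤ N → Zone y
  zone {y} y≤N with y ≤? K
  ... | yes y≤K = low y≤K
  ... | no y≰K with ≤-suc-cases (m≤n+o⇒m∸n≤o y K (subst (y ≤_) (+-comm (suc m) K) y≤N))
  ...   | inj₁ j≤m = mid (m<n⇒0<n∸m (≰⇒> y≰K)) j≤m (sym (m∸n+n≡m (<⇒≤ (≰⇒> y≰K))))
  ...   | inj₂ j≡  = top (trans (sym (m∸n+n≡m (<⇒≤ (≰⇒> y≰K)))) (cong (_+ K) j≡))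

  σ-closed : ∀ {j} → In (suc m) j → In (suc m) (apply σ j)
  σ-closed (1≤j , j≤) with ≤-suc-cases j≤
  ... | inj₁ j≤m  = ≤-trans (n≤1+n 1) (proj₁ (σ-in 1≤j j≤m)) , proj₂ (σ-in 1≤j j≤m)
  ... | inj₂ refl = subst (In (suc m)) (sym σ-top) (≤-refl , s≤s z≤n)

  π-closed : ∀ {y} → In N y → In N (apply π y)
  π-closed (1≤y , y≤N) with zone y≤N
  ... | low y≤K rewrite π≈τ 1≤y y≤K =
    let (1≤ , ≤sK) = τ-in (1≤y , m≤n⇒m≤1+n y≤K) in 1≤ , ≤-trans ≤sK sK≤N
  ... | mid 1≤j j≤m refl rewrite π≈σ 1≤j j≤m =
    let (2≤ , ≤sm) = σ-in 1≤j j≤m in ≤-trans (n≤1+n 1) (≤-trans 2≤ (m≤m+n _ K)) , +-monoˡ-≤ K ≤sm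
  ... | top refl rewrite π-top = ≤-refl , s≤s z≤n

  module _ (cτ : Cyclic (suc K) τ) (cσ : Cyclic (suc m) σ) where

    1↝hub : Reach π 1 (suc K)
    1↝hub = simulate-until (suc K) step (≤-refl , s≤s z≤n) (cτ 1 (suc K) ≤-refl (s≤s z≤n) (s≤s z≤n) ≤-refl)
      where
      open Simulation (In (suc K)) {τ} {π} id τ-in
      step : ∀ {y} → In (suc K) y → y ≢ suc K → apply π y ≡ apply τ y
      step (1≤y , y≤) y≢ = π≈τ 1≤y (s≤s⁻¹ (≤∧≢⇒< y≤ y≢))

    hub↝top : Reach π (suc K) N
    hub↝top = simulate-until (suc m) step (≤-refl , s≤s z≤n) (cσ 1 (suc m) ≤-refl (s≤s z≤n) (s≤s z≤n) ≤-refl)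
      where
      open Simulation (In (suc m)) {σ} {π} (_+ K) σ-closed
      step : ∀ {j} → In (suc m) j → j ≢ suc m → apply π (j + K) ≡ apply σ j + K
      step (1≤j , j≤) j≢ = π≈σ 1≤j (s≤s⁻¹ (≤∧≢⇒< j≤ j≢))

    hub↝1 : Reach π (suc K) 1
    hub↝1 = reach-trans hub↝top (reach-step π-top)

    top↝hub : Reach π N (suc K)
    top↝hub = reach-trans (reach-step π-top) 1↝hub

    τ-step : ∀ {y} → In (suc K) y → Reach π y (apply τ y)
    τ-step (1≤y , y≤) with ≤-suc-cases y≤
    ... | inj₁ y≤K  = reach-step (π≈τ 1≤y y≤K)
    ... | inj₂ refl = subst (Reach π (suc K)) (sym τ-top) hub↝1

    σ-step : ∀ {j} → In (suc m) j → Reach π (j + K) (apply σ j + K)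
    σ-step (1≤j , j≤) with ≤-suc-cases j≤
    ... | inj₁ j≤m  = reach-step (π≈σ 1≤j j≤m)
    ... | inj₂ refl = subst (λ s → Reach π N (s + K)) (sym σ-top) top↝hub

    τ-hub↔ : ∀ {x} → In (suc K) x → Reach π (suc K) x × Reach π x (suc K)
    τ-hub↔ {x} x∈ =
      simulate τ-step (s≤s z≤n , ≤-refl) (cτ (suc K) x (s≤s z≤n) ≤-refl (proj₁ x∈) (proj₂ x∈)) ,
      simulate τ-step x∈ (cτ x (suc K) (proj₁ x∈) (proj₂ x∈) (s≤s z≤n) ≤-refl)
      where open Simulation (In (suc K)) {τ} {π} id τ-in

    σ-hub↔ : ∀ {j} → In (suc m) j → Reach π (suc K) (j + K) × Reach π (j + K) (suc K)
    σ-hub↔ {j} j∈ =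
      simulate σ-step (≤-refl , s≤s z≤n) (cσ 1 j ≤-refl (s≤s z≤n) (proj₁ j∈) (proj₂ j∈)) ,
      simulate σ-step j∈ (cσ j 1 (proj₁ j∈) (proj₂ j∈) ≤-refl (s≤s z≤n))
      where open Simulation (In (suc m)) {σ} {π} (_+ K) σ-closed

    hub↔ : ∀ {x} → In N x → Reach π (suc K) x × Reach π x (suc K)
    hub↔ (1≤x , x≤N) with zone x≤N
    ... | low x≤K            = τ-hub↔ (1≤x , m≤n⇒m≤1+n x≤K)
    ... | mid 1≤j j≤m refl   = σ-hub↔ (1≤j , m≤n⇒m≤1+n j≤m)
    ... | top refl           = σ-hub↔ (s≤s z≤n , ≤-refl)

    spliced-cyclic : Cyclic N π
    spliced-cyclic i j 1≤i i≤N 1≤j j≤N =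
      reach-trans (proj₂ (hub↔ (1≤i , i≤N))) (proj₁ (hub↔ (1≤j , j≤N)))

  module _ (cπ : Cyclic N π) where

    -- Collapsing everything above K + 1 onto K + 1 turns a run of π into a run of τ.
    cyclic-τ : Cyclic (suc K) τ
    cyclic-τ i j 1≤i i≤ 1≤j j≤ =
      subst₂ (Reach τ) (m≤n⇒m⊓n≡m i≤) (m≤n⇒m⊓n≡m j≤)
        (simulate step (1≤i , ≤-trans i≤ sK≤N) (cπ i j 1≤i (≤-trans i≤ sK≤N) 1≤j (≤-trans j≤ sK≤N)))
      where
      open Simulation (In N) {π} {τ} (_⊓ suc K) π-closed
      step : ∀ {y} → In N y → Reach τ (y ⊓ suc K) (apply π y ⊓ suc K)
      step (1≤y , y≤N) with zone y≤N
      ... | low y≤K rewrite π≈τ 1≤y y≤K =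
        subst₂ (Reach τ) (sym (m≤n⇒m⊓n≡m (m≤n⇒m≤1+n y≤K))) (sym (m≤n⇒m⊓n≡m (proj₂ (τ-in (1≤y , m≤n⇒m≤1+n y≤K)))))
          (reach-step refl)
      ... | mid 1≤j j≤m refl rewrite π≈σ 1≤j j≤m =
        subst₂ (Reach τ) (sym (m≥n⇒m⊓n≡n (+-monoˡ-≤ K 1≤j)))
          (sym (m≥n⇒m⊓n≡n (+-monoˡ-≤ K (≤-trans (n≤1+n 1) (proj₁ (σ-in 1≤j j≤m)))))) reach-refl
      ... | top refl rewrite π-top = subst (λ a → Reach τ a 1) (sym (m≥n⇒m⊓n≡n sK≤N)) (reach-step τ-top)

    -- Collapsing everything below K + 1 onto K + 1 turns a run of π into a run of σ (shifted by K).
    cyclic-σ : Cyclic (suc m) σ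
    cyclic-σ i j 1≤i i≤ 1≤j j≤ =
      subst₂ (Reach σ) (collapse-shift 1≤i) (collapse-shift 1≤j)
        (simulate step (≤-trans 1≤i (m≤m+n i K) , +-monoˡ-≤ K i≤)
          (cπ (i + K) (j + K) (≤-trans 1≤i (m≤m+n i K)) (+-monoˡ-≤ K i≤) (≤-trans 1≤j (m≤m+n j K)) (+-monoˡ-≤ K j≤)))
      where
      collapse : ℕ → ℕ
      collapse y = (y ∸ K) ⊔ 1
      collapse-shift : ∀ {j} → 1 ≤ j → collapse (j + K) ≡ j
      collapse-shift {j} 1≤j = trans (cong (_⊔ 1) (m+n∸n≡m j K)) (m≥n⇒m⊔n≡m 1≤j)
      collapse-low : ∀ {y} → y ≤ suc K → collapse y ≡ 1
      collapse-low {y} y≤ = m≤n⇒m⊔n≡n (subst (y ∸ K ≤_) (m+n∸n≡m 1 K) (∸-monoˡ-≤ K y≤))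
      open Simulation (In N) {π} {σ} collapse π-closed
      step : ∀ {y} → In N y → Reach σ (collapse y) (collapse (apply π y))
      step (1≤y , y≤N) with zone y≤N
      ... | low y≤K rewrite π≈τ 1≤y y≤K =
        subst₂ (Reach σ) (sym (collapse-low (m≤n⇒m≤1+n y≤K)))
          (sym (collapse-low (proj₂ (τ-in (1≤y , m≤n⇒m≤1+n y≤K))))) reach-refl
      ... | mid 1≤j j≤m refl rewrite π≈σ 1≤j j≤m =
        subst₂ (Reach σ) (sym (collapse-shift 1≤j))
          (sym (collapse-shift (≤-trans (n≤1+n 1) (proj₁ (σ-in 1≤j j≤m))))) (reach-step refl)
      ... | top refl rewrite π-top =
        subst₂ (Reach σ) (sym (collapse-shift (s≤s z≤n))) (sym (collapse-low (s≤s z≤n))) (reach-step σ-top)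

  spliced-cyclic⇔ : Cyclic N π ⇔ (Cyclic (suc K) τ × Cyclic (suc m) σ)
  spliced-cyclic⇔ = mk⇔ (λ cπ → cyclic-τ cπ , cyclic-σ cπ) (λ (cτ , cσ) → spliced-cyclic cτ cσ)

nth-++-+ : ∀ u v j → nth (u ++ v) (length u + j) ≡ nth v j
nth-++-+ []      v j = refl
nth-++-+ (_ ∷ u) v j = nth-++-+ u v j

nth-++-length : ∀ u v → nth (u ++ v) (length u) ≡ nth v 0
nth-++-length []      v = refl
nth-++-length (_ ∷ u) v = nth-++-length u v

nth-++-< : ∀ u v {i} → i < length u → nth (u ++ v) i ≡ nth u i
nth-++-< (_ ∷ u) v {zero}  _       = refl
nth-++-< (_ ∷ u) v {suc i} (s≤s i<) = nth-++-< u v i<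

nth-++-∷-≤ : ∀ u x v v′ {i} → i ≤ length u → nth (u ++ x ∷ v) i ≡ nth (u ++ x ∷ v′) i
nth-++-∷-≤ []      x v v′ {zero}  _        = refl
nth-++-∷-≤ (_ ∷ u) x v v′ {zero}  _        = refl
nth-++-∷-≤ (_ ∷ u) x v v′ {suc i} (s≤s i≤) = nth-++-∷-≤ u x v v′ i≤

nth-∈ : ∀ w {i} → i < length w → nth w i ∈ w
nth-∈ (_ ∷ w) {zero}  _       = here refl
nth-∈ (_ ∷ w) {suc i} (s≤s i<) = there (nth-∈ w i<)

nth-map : ∀ f w i → f 0 ≡ 0 → nth (map f w) i ≡ f (nth w i)
nth-map f []      i       f0 = sym f0
nth-map f (_ ∷ w) zero    f0 = refl
nth-map f (_ ∷ w) (suc i) f0 = nth-map f w i f0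

-- The decomposition π = α 2 β 1

∸-reflectsˡ-< : ∀ o {m n} → m ∸ o < n ∸ o → m < n
∸-reflectsˡ-< o lt = ≰⇒> (λ n≤m → <⇒≱ lt (∸-monoˡ-≤ o n≤m))

×-transpose : ∀ {A B C D : Set} → ((A × B) × (C × D)) ⇔ ((A × C) × (B × D))
×-transpose = mk⇔ (λ ((a , b) , (c , d)) → (a , c) , (b , d)) (λ ((a , c) , (b , d)) → (a , b) , (c , d))

module Decomposition (α β : List ℕ) where

  k m K : ℕ
  k = length α
  m = length β
  K = suc k

  π τ σ : List ℕ
  π = α ++ 2 ∷ β ++ [ 1 ]
  τ = α ++ 2 ∷ [ 1 ]
  σ = red (β ++ [ 1 ])

  π↭ : π ↭ 1 ∷ 2 ∷ α ++ β
  π↭ = begin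
    α ++ 2 ∷ β ++ [ 1 ]   ↭⟨ shift 2 α (β ++ [ 1 ]) ⟩
    2 ∷ α ++ β ++ [ 1 ]   ↭⟨ prep 2 (++⁺ˡ α (↭-sym (∷↭∷ʳ 1 β))) ⟩
    2 ∷ α ++ 1 ∷ β        ↭⟨ prep 2 (shift 1 α β) ⟩
    2 ∷ 1 ∷ α ++ β        ↭⟨ swap 2 1 ↭-refl ⟩
    1 ∷ 2 ∷ α ++ β        ∎
    where open PermutationReasoning

  τ↭ : τ ↭ 1 ∷ 2 ∷ α
  τ↭ = begin
    α ++ 2 ∷ [ 1 ]   ↭⟨ shift 2 α [ 1 ] ⟩
    2 ∷ α ++ [ 1 ]   ↭⟨ prep 2 (↭-sym (∷↭∷ʳ 1 α)) ⟩
    2 ∷ 1 ∷ α        ↭⟨ swap 2 1 ↭-refl ⟩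
    1 ∷ 2 ∷ α        ∎
    where open PermutationReasoning

  perm-split : ∀ {n} → IsPerm n π → n ≡ suc (suc (k + m)) × α ++ β ↭ segment 2 (k + m)
  perm-split {n} p = n≡ , drop-∷ (drop-∷ (subst (1 ∷ 2 ∷ α ++ β ↭_) range≡ q))
    where
    q : 1 ∷ 2 ∷ α ++ β ↭ range n
    q = ↭-trans (↭-sym π↭) p
    n≡ : n ≡ suc (suc (k + m))
    n≡ = trans (sym (trans (↭-length q) (trans (cong length (range≡segment n)) (length-segment 0 n))))
               (cong (λ l → suc (suc l)) (length-++ α))
    range≡ : range n ≡ 1 ∷ 2 ∷ segment 2 (k + m)
    range≡ = trans (range≡segment n) (cong (segment 0) n≡)

  τ-perm⇔ : IsPerm (k + 2) τ ⇔ (α ↭ segment 2 k)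
  τ-perm⇔ = mk⇔
    (λ p → drop-∷ (drop-∷ (subst (1 ∷ 2 ∷ α ↭_) range≡ (↭-trans (↭-sym τ↭) p))))
    (λ p → subst (τ ↭_) (sym range≡) (↭-trans τ↭ (prep 1 (prep 2 p))))
    where
    range≡ : range (k + 2) ≡ 1 ∷ 2 ∷ segment 2 k
    range≡ = trans (range≡segment (k + 2)) (cong (segment 0) (+-comm k 2))

  -- An entry x of α above an entry y of β would form the pattern x 2 y.
  avoid⇒α-lower : ¬ Has312 π → α ++ β ↭ segment 2 (k + m) → α ↭ segment 2 k
  avoid⇒α-lower ¬p p = lower-block 2 (k + m) α β p α<β
    where
    α<β : ∀ {x y} → x ∈ α → y ∈ β → x < y
    α<β {x} {y} x∈ y∈ with y <? x
    ... | yes y<x = contradiction (Has312-++⁺-across x∈ 2<y y<x (here (∈-++⁺ˡ y∈))) ¬p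
      where
      2<y : 2 < y
      2<y = proj₁ (∈-segment⁻ 2 (k + m) (∈-resp-↭ p (∈-++⁺ʳ α y∈)))
    ... | no y≮x = ≤∧≢⇒< (≮⇒≥ y≮x) (unique-++⇒≢ α (unique-↭ (↭-sym p) (segment-unique 2 (k + m))) x∈ y∈)

  β-upper : α ↭ segment 2 k → α ++ β ↭ segment 2 (k + m) → β ↭ segment (suc K) m
  β-upper αp p = ++-cancelˡ-↭ (segment 2 k) (↭-trans (↭-sym (++⁺ʳ β αp)) (subst (α ++ β ↭_) segments p))
    where
    segments : segment 2 (k + m) ≡ segment 2 k ++ segment (suc K) m
    segments = trans (segment-++ 2 k m) (cong (λ a → segment 2 k ++ segment a m) (+-comm k 2))

  module Blocks (αp : α ↭ segment 2 k) (βp : β ↭ segment (suc K) m) where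

    α-bounds : ∀ {x} → x ∈ α → 2 < x × x ≤ suc K
    α-bounds x∈ = ∈-segment⁻ 2 k (∈-resp-↭ αp x∈)

    β-bounds : ∀ {y} → y ∈ β → suc K < y × y ≤ suc K + m
    β-bounds y∈ = ∈-segment⁻ (suc K) m (∈-resp-↭ βp y∈)

    K<β : ∀ {y} → y ∈ β → K < y
    K<β y∈ = <-trans (n<1+n K) (proj₁ (β-bounds y∈))

    σ≡ : σ ≡ map (_∸ K) β ++ [ 1 ]
    σ≡ = red-shift K m β βp

    head : List ℕ
    head = α ++ [ 2 ]

    π≡ : π ≡ (head ++ β) ++ [ 1 ]
    π≡ = sym (trans (++-assoc-≡ head β [ 1 ]) (++-assoc-≡ α [ 2 ] (β ++ [ 1 ])))

    τ≡ : τ ≡ head ++ [ 1 ]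
    τ≡ = sym (++-assoc-≡ α [ 2 ] [ 1 ])

    τ-bounds : ∀ {x} → x ∈ τ → In (suc K) x
    τ-bounds x∈ with ∈-++⁻ α x∈
    ... | inj₁ x∈α              = ≤-trans (n≤1+n 1) (<⇒≤ (proj₁ (α-bounds x∈α))) , proj₂ (α-bounds x∈α)
    ... | inj₂ (here refl)         = s≤s z≤n , s≤s (s≤s z≤n)
    ... | inj₂ (there (here refl)) = ≤-refl , s≤s z≤n

    head-bounds : ∀ {x} → x ∈ head → In (suc K) x
    head-bounds x∈ = τ-bounds (subst (_ ∈_) (sym τ≡) (∈-++⁺ˡ x∈))

    τ→head : Has312 τ → Has312 head
    τ→head p = Has312-∷ʳ-min head (All.tabulate (λ x∈ → proj₁ (head-bounds x∈))) (subst Has312 τ≡ p)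

    σ→β : Has312 σ → Has312 β
    σ→β p = Has312-map⁻ (_∸ K) (∸-reflectsˡ-< K) β
      (Has312-∷ʳ-min (map (_∸ K) β) (All-map⁺ (All.tabulate (λ y∈ → m<n⇒0<n∸m (K<β y∈)))) (subst Has312 σ≡ p))

    β→σ : Has312 β → Has312 σ
    β→σ q = subst Has312 (sym σ≡) (Has312-++⁺ˡ [ 1 ] (Has312-map⁺ (_∸ K) shift-mono q))
      where
      shift-mono : ∀ {a b} → a ∈ β → b ∈ β → a < b → a ∸ K < b ∸ K
      shift-mono a∈ _ a<b = ∸-monoˡ-< a<b (<⇒≤ (K<β a∈))

    head→τ : Has312 head → Has312 τ
    head→τ q = subst Has312 (sym τ≡) (Has312-++⁺ˡ [ 1 ] q)

    -- The final 1 lies below every entry, and head lies entirely below β.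
    π→τ⊎σ : Has312 π → Has312 τ ⊎ Has312 σ
    π→τ⊎σ p = Sum.map head→τ β→σ
      (Has312-++-stacked head head<β (Has312-∷ʳ-min (head ++ β) (All.tabulate 1≤) (subst Has312 π≡ p)))
      where
      head<β : ∀ {x y} → x ∈ head → y ∈ β → x < y
      head<β x∈ y∈ = ≤-<-trans (proj₂ (head-bounds x∈)) (proj₁ (β-bounds y∈))
      1≤ : ∀ {x} → x ∈ head ++ β → 1 ≤ x
      1≤ x∈ with ∈-++⁻ head x∈
      ... | inj₁ x∈h = proj₁ (head-bounds x∈h)
      ... | inj₂ x∈β = ≤-trans (s≤s z≤n) (<⇒≤ (K<β x∈β))

    τ⊎σ→π : Has312 τ ⊎ Has312 σ → Has312 π
    τ⊎σ→π (inj₁ p) = subst Has312 (sym π≡) (Has312-++⁺ˡ [ 1 ] (Has312-++⁺ˡ β (τ→head p)))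
    τ⊎σ→π (inj₂ p) = Has312-++⁺ʳ α (there (Has312-++⁺ˡ [ 1 ] (σ→β p)))

    π≈τ : ∀ {y} → 1 ≤ y → y ≤ K → apply π y ≡ apply τ y
    π≈τ {y} _ y≤K = nth-++-∷-≤ α 2 (β ++ [ 1 ]) [ 1 ] (∸-monoˡ-≤ 1 y≤K)

    τ-in : ∀ {y} → In (suc K) y → In (suc K) (apply τ y)
    τ-in {y} (_ , y≤) = τ-bounds (nth-∈ τ (subst (y ∸ 1 <_) length-τ (s≤s (∸-monoˡ-≤ 1 y≤))))
      where
      length-τ : suc K ≡ length τ
      length-τ = sym (trans (length-++ α) (+-comm k 2))

    τ-top : apply τ (suc K) ≡ 1
    τ-top = trans (cong (nth τ) (+-comm 1 k)) (nth-++-+ α (2 ∷ [ 1 ]) 1)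

    σ-entry : ∀ {i} → i < m → nth σ i ≡ nth β i ∸ K
    σ-entry {i} i<m = begin
      nth σ i                        ≡⟨ cong (λ w → nth w i) σ≡ ⟩
      nth (map (_∸ K) β ++ [ 1 ]) i  ≡⟨ nth-++-< (map (_∸ K) β) [ 1 ] i<length ⟩
      nth (map (_∸ K) β) i           ≡⟨ nth-map (_∸ K) β i refl ⟩
      nth β i ∸ K                    ∎
      where
      open ≡-Reasoning
      i<length : i < length (map (_∸ K) β)
      i<length = subst (i <_) (sym (length-map (_∸ K) β)) i<m

    nth-β-bounds : ∀ {i} → i < m → suc K < nth β i × nth β i ≤ suc K + m
    nth-β-bounds i<m = β-bounds (nth-∈ β i<m)

    π≈σ : ∀ {j} → 1 ≤ j → j ≤ m → apply π (j + K) ≡ apply σ j + K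
    π≈σ {suc i} _ i<m = begin
      nth π (i + K)                  ≡⟨ cong (nth π) (trans (+-comm i K) (sym (+-suc k i))) ⟩
      nth π (k + suc i)              ≡⟨ nth-++-+ α (2 ∷ β ++ [ 1 ]) (suc i) ⟩
      nth (β ++ [ 1 ]) i             ≡⟨ nth-++-< β [ 1 ] i<m ⟩
      nth β i                        ≡⟨ sym (m∸n+n≡m (<⇒≤ (K<β (nth-∈ β i<m)))) ⟩
      nth β i ∸ K + K                ≡⟨ cong (_+ K) (sym (σ-entry i<m)) ⟩
      nth σ i + K                    ∎
      where open ≡-Reasoning

    σ-in : ∀ {j} → 1 ≤ j → j ≤ m → 2 ≤ apply σ j × apply σ j ≤ suc m
    σ-in {suc i} _ i<m rewrite σ-entry i<m =
      subst (_≤ nth β i ∸ K) (m+n∸n≡m 2 K) (∸-monoˡ-≤ K (proj₁ (nth-β-bounds i<m))) ,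
      subst (nth β i ∸ K ≤_) (trans (cong (_∸ K) (sym (+-suc K m))) (m+n∸m≡n K (suc m)))
            (∸-monoˡ-≤ K (proj₂ (nth-β-bounds i<m)))

    π-top : apply π (suc m + K) ≡ 1
    π-top = begin
      nth π (m + K)                  ≡⟨ cong (nth π) (trans (+-comm m K) (sym (+-suc k m))) ⟩
      nth π (k + suc m)              ≡⟨ nth-++-+ α (2 ∷ β ++ [ 1 ]) (suc m) ⟩
      nth (β ++ [ 1 ]) m             ≡⟨ nth-++-length β [ 1 ] ⟩
      1                              ∎
      where open ≡-Reasoning

    σ-top : apply σ (suc m) ≡ 1
    σ-top = begin
      nth σ m                                               ≡⟨ cong (λ w → nth w m) σ≡ ⟩
      nth (map (_∸ K) β ++ [ 1 ]) m                         ≡⟨ cong (nth (map (_∸ K) β ++ [ 1 ])) (sym (length-map (_∸ K) β)) ⟩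
      nth (map (_∸ K) β ++ [ 1 ]) (length (map (_∸ K) β))  ≡⟨ nth-++-length (map (_∸ K) β) [ 1 ] ⟩
      1                                                     ∎
      where open ≡-Reasoning

    open Splice K m π τ σ π≈τ τ-in τ-top π≈σ σ-in π-top σ-top using (spliced-cyclic⇔)

    avoids⇔ : Avoids π p312 ⇔ (Avoids τ p312 × Avoids σ p312)
    avoids⇔ = mk⇔
      (λ aπ → from avoids⇔¬Has312 (to avoids⇔¬Has312 aπ ∘ τ⊎σ→π ∘ inj₁) ,
              from avoids⇔¬Has312 (to avoids⇔¬Has312 aπ ∘ τ⊎σ→π ∘ inj₂))
      (λ (aτ , aσ) → from avoids⇔¬Has312 (Sum.[ to avoids⇔¬Has312 aτ , to avoids⇔¬Has312 aσ ] ∘ π→τ⊎σ))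
      where open Equivalence

    cyclic⇔ : ∀ {n} → n ≡ suc (suc (k + m)) → Cyclic n π ⇔ (Cyclic (k + 2) τ × Cyclic (n ∸ k ∸ 1) σ)
    cyclic⇔ refl = ⇔-trans (resize π-size) (⇔-trans spliced-cyclic⇔ (resize τ-size ×-⇔ resize σ-size))
      where
      resize : ∀ {a b w} → a ≡ b → Cyclic a w ⇔ Cyclic b w
      resize refl = ⇔-refl
      π-size : suc (suc (k + m)) ≡ suc m + K
      π-size = cong suc (trans (cong suc (+-comm k m)) (sym (+-suc m k)))
      τ-size : suc K ≡ k + 2
      τ-size = +-comm 2 k
      n≡k+ : suc (suc (k + m)) ≡ k + suc (suc m)
      n≡k+ = sym (trans (+-suc k (suc m)) (cong suc (+-suc k m)))
      σ-size : suc m ≡ suc (suc (k + m)) ∸ k ∸ 1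
      σ-size = sym (cong (_∸ 1) (trans (cong (_∸ k) n≡k+) (m+n∸m≡n k (suc (suc m)))))

    decomposition : ∀ {n} → n ≡ suc (suc (k + m)) →
      (Cyclic n π × Avoids π p312) ⇔
      ((Cyclic (k + 2) τ × Avoids τ p312) × (Cyclic (n ∸ k ∸ 1) σ × Avoids σ p312))
    decomposition n≡ = ⇔-trans (cyclic⇔ n≡ ×-⇔ avoids⇔) ×-transpose

lemma3p2 : (n : ℕ) → 2 ≤ n → (α β : List ℕ) →
    IsPerm n (α ++ 2 ∷ β ++ 1 ∷ []) →
    ((Cyclic n (α ++ 2 ∷ β ++ 1 ∷ []) × Avoids (α ++ 2 ∷ β ++ 1 ∷ []) p312)
      ⇔ ((IsPerm (length α + 2) (α ++ 2 ∷ 1 ∷ [])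
           × Cyclic (length α + 2) (α ++ 2 ∷ 1 ∷ [])
           × Avoids (α ++ 2 ∷ 1 ∷ []) p312)
         × (Cyclic (n ∸ length α ∸ 1) (red (β ++ 1 ∷ []))
           × Avoids (red (β ++ 1 ∷ [])) p312)))
lemma3p2 n _ α β π-perm = mk⇔
  (λ (cπ , aπ) →
    let αp = avoid⇒α-lower (to avoids⇔¬Has312 aπ) αβ↭
        ((cτ , aτ) , σ-part) = to (decomposition αp) (cπ , aπ)
    in (from τ-perm⇔ αp , cτ , aτ) , σ-part)
  (λ ((τp , cτ , aτ) , σ-part) → from (decomposition (to τ-perm⇔ τp)) ((cτ , aτ) , σ-part))
  where
  open Equivalence
  open Decomposition α β
  αβ↭ : α ++ β ↭ segment 2 (k + m)
  αβ↭ = proj₂ (perm-split π-perm)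
  decomposition : α ↭ segment 2 k →
    (Cyclic n π × Avoids π p312) ⇔
    ((Cyclic (k + 2) τ × Avoids τ p312) × (Cyclic (n ∸ k ∸ 1) σ × Avoids σ p312))
  decomposition αp = Blocks.decomposition αp (β-upper αp αβ↭) (proj₁ (perm-split π-perm))
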